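{- Let $k\ge 3$ and let $G$ be a $k$-regular Moore graph of diameter $2$ (i.e., a $k$-regular graph of diameter $2$ and girth $5$). Then $k\le \beta(G)\le 2k-3$.
   Context: A set $S$ of vertices of a connected graph $G$ is resolving if distinct vertices have distinct vectors of distances to the elements of $S$; the metric dimension $\beta(G)$ is the minimum cardinality of a resolving set. -}

module Defs where

open import Data.Nat using (ℕ; zero; suc; _≤_)
open import Data.Empty using (⊥)
open import Data.Fin using (Fin; zero; suc; inject₁; fromℕ)
open import Data.Fin.Subset using (Subset; _∈_; ∣_∣)
open import Data.Vec using (tabulate)
open import Data.Product using (Σ; _×_; ∃; ∃-syntax; _,_)
open import Relation.Nullary using (¬_; Dec; does)
open import Relation.Binary.PropositionalEquality using (_≡_)
open import Function.Definitions using (Injective)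

record Graph (n : ℕ) : Set₁ where
  field
    Adj   : Fin n → Fin n → Set
    adj?  : ∀ u v → Dec (Adj u v)
    sym   : ∀ {u v} → Adj u v → Adj v u
    irrefl : ∀ {u} → ¬ Adj u u

module _ {n : ℕ} (G : Graph n) where
  open Graph G

  data Walk : Fin n → Fin n → ℕ → Set where
    here : ∀ {u} → Walk u u 0
    step : ∀ {u w v m} → Adj u w → Walk w v m → Walk u v (suc m)

  Dist : Fin n → Fin n → ℕ → Set
  Dist u v d = Walk u v d × (∀ m → Walk u v m → d ≤ m)

  nbhd : Fin n → Subset n
  nbhd u = tabulate (λ v → does (adj? u v))

  degree : Fin n → ℕ
  degree u = ∣ nbhd u ∣

  Regular : ℕ → Set
  Regular k = ∀ u → degree u ≡ k

  Diameter : ℕ → Set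
  Diameter D = (∀ u v → ∃[ d ] (Dist u v d × d ≤ D))
             × (∃[ u ] ∃[ v ] Dist u v D)

  -- A cycle of length (suc m): distinct vertices c 0, …, c m with
  -- consecutive ones adjacent and c m adjacent to c 0; length ≥ 3.
  Cycle : (m : ℕ) → (Fin (suc m) → Fin n) → Set
  Cycle m c = 2 ≤ m × Injective _≡_ _≡_ c
            × (∀ (i : Fin m) → Adj (c (inject₁ i)) (c (suc i)))
            × Adj (c (fromℕ m)) (c zero)

  Girth : ℕ → Set
  Girth zero = ⊥
  Girth (suc g) = (∃[ c ] Cycle g c)
                × (∀ m c → Cycle m c → g ≤ m)

  Resolving : Subset n → Set
  Resolving S = ∀ x y →
    (∀ s → s ∈ S → ∀ d → Dist x s d → Dist y s d) → x ≡ y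

module Submission where

-- Let G be k-regular (k ≥ 3) with diameter 2 and girth 5.  Girth 5 means
-- that G has no triangle and no 4-cycle, so two distinct vertices have at
-- most one common neighbour.  Diameter 2 means that the distance from x to
-- s is 0, 1 or 2 according as x ≡ s, x ~ s or neither; hence a set S is
-- resolving exactly when vertices agreeing on these three-valued distances
-- to all of S coincide.
--
-- Lower bound: fix s₀.  Every s ≢ s₀ is within distance 1 of at most one
-- neighbour of s₀.  If ∣ S - s₀ ∣ ≤ k - 2, two neighbours of s₀ are within
-- distance 1 of no element of S - s₀; they have the same distances to all
-- of S, so S is not resolving.  Taking s₀ ∈ S gives k ≤ ∣ S ∣.
--
-- Upper bound: for an edge v ~ u and a further neighbour w of u, the set
-- (N(v) - u) ∪ (N(u) - v - w) has at most 2k - 3 elements and resolves G: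
-- a vertex outside it is v, u, w, or reaches v through a vertex of N(v) - u,
-- and girth 5 separates any two such vertices by their neighbours in S.

open import Defs
open import Data.Nat using (ℕ; zero; suc; _≤_; _<_; _∸_; _*_; _+_; z≤n; s≤s)
open import Data.Nat.Properties
  using (≤-refl; ≤-trans; ≤-reflexive; ≤-antisym; n≤1+n; +-mono-≤; +-monoʳ-≤; +-suc; +-comm; +-identityʳ;
         _≤?_; ≰⇒>; <⇒≱; m+n≤o⇒m≤o∸n; module ≤-Reasoning)
open import Data.Bool using (Bool; true; false)
open import Data.Fin using (Fin; zero; suc; _≟_; inject₁)
open import Data.Fin.Subset using (Subset; ∣_∣; _∈_; _∉_; _∪_; _-_; ⁅_⁆; _⊆_) renaming (⊥ to ∅)
open import Data.Fin.Subset.Properties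
  using (_∈?_; p⊆q⇒∣p∣≤∣q∣; x∈p∪q⁺; ∣⁅x⁆∣≡1; ∣⊥∣≡0; x∈⁅x⁆; x∈p∧x≢y⇒x∈p-y; x∈p⇒∣p-x∣<∣p∣;
         nonempty?; Empty-unique)
open import Data.Fin.Properties using (any?)
open import Data.Vec.Base as Vec using (_∷_; []; tabulate)
open import Data.Vec.Properties using ([]=⇒lookup; lookup⇒[]=; lookup∘tabulate)
open import Data.Product using (_×_; ∃-syntax; _,_)
open import Data.Sum using (_⊎_; inj₁; inj₂)
open import Data.Empty using (⊥; ⊥-elim)
open import Relation.Nullary using (¬_; Dec; yes; no; does; _×-dec_; ¬?; _⊎-dec_)
open import Relation.Nullary.Decidable using (dec-true)
open import Relation.Binary.PropositionalEquality using (_≡_; _≢_; refl; sym; trans; subst; cong)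

∈-tabulate⁺ : ∀ {m} (f : Fin m → Bool) x → f x ≡ true → x ∈ tabulate f
∈-tabulate⁺ f x fx = lookup⇒[]= x (tabulate f) (trans (lookup∘tabulate f x) fx)

∈-tabulate⁻ : ∀ {m} (f : Fin m → Bool) x → x ∈ tabulate f → f x ≡ true
∈-tabulate⁻ f x x∈ = trans (sym (lookup∘tabulate f x)) ([]=⇒lookup x∈)

select : ∀ {m} {P : Fin m → Set} → (∀ x → Dec (P x)) → Subset m
select P? = tabulate (λ x → does (P? x))

∈-select⁺ : ∀ {m} {P : Fin m → Set} (P? : ∀ x → Dec (P x)) {x} → P x → x ∈ select P?
∈-select⁺ P? {x} px = ∈-tabulate⁺ _ x (dec-true (P? x) px)

∈-select⁻ : ∀ {m} {P : Fin m → Set} (P? : ∀ x → Dec (P x)) {x} → x ∈ select P? → P x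
∈-select⁻ P? {x} x∈ = witness (P? x) (∈-tabulate⁻ _ x x∈)
  where
  witness : ∀ {A : Set} (a? : Dec A) → does a? ≡ true → A
  witness (yes a) _ = a

x∉p-x : ∀ {m} (p : Subset m) x → x ∉ p - x
x∉p-x (true ∷ p) zero ()
x∉p-x (false ∷ p) zero ()
x∉p-x (b ∷ p) (suc x) (Vec.there x∈) = x∉p-x p x x∈

∈p-y⇒≢ : ∀ {m} {p : Subset m} {x y} → x ∈ p - y → x ≢ y
∈p-y⇒≢ {p = p} {x} x∈ refl = x∉p-x p x x∈

∣p∪q∣≤∣p∣+∣q∣ : ∀ {m} (p q : Subset m) → ∣ p ∪ q ∣ ≤ ∣ p ∣ + ∣ q ∣
∣p∪q∣≤∣p∣+∣q∣ [] [] = z≤n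
∣p∪q∣≤∣p∣+∣q∣ (true ∷ p) (true ∷ q) = s≤s (≤-trans (∣p∪q∣≤∣p∣+∣q∣ p q) (+-monoʳ-≤ ∣ p ∣ (n≤1+n _)))
∣p∪q∣≤∣p∣+∣q∣ (true ∷ p) (false ∷ q) = s≤s (∣p∪q∣≤∣p∣+∣q∣ p q)
∣p∪q∣≤∣p∣+∣q∣ (false ∷ p) (true ∷ q) = ≤-trans (s≤s (∣p∪q∣≤∣p∣+∣q∣ p q)) (≤-reflexive (sym (+-suc ∣ p ∣ ∣ q ∣)))
∣p∪q∣≤∣p∣+∣q∣ (false ∷ p) (false ∷ q) = ∣p∪q∣≤∣p∣+∣q∣ p q

∃-outside : ∀ {m} (p q : Subset m) → ∣ q ∣ < ∣ p ∣ → ∃[ x ] (x ∈ p × x ∉ q)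
∃-outside p q ∣q∣<∣p∣ with any? (λ x → (x ∈? p) ×-dec ¬? (x ∈? q))
... | yes found = found
... | no none = ⊥-elim (<⇒≱ ∣q∣<∣p∣ (p⊆q⇒∣p∣≤∣q∣ p⊆q))
  where
  p⊆q : p ⊆ q
  p⊆q {x} x∈p with x ∈? q
  ... | yes x∈q = x∈q
  ... | no x∉q = ⊥-elim (none (x , x∈p , x∉q))

two-outside : ∀ {m} (p q : Subset m) → 2 + ∣ q ∣ ≤ ∣ p ∣ →
  ∃[ x ] ∃[ y ] (x ∈ p × y ∈ p × x ∉ q × y ∉ q × x ≢ y)
two-outside p q 2+∣q∣≤∣p∣ with ∃-outside p q (≤-trans (n≤1+n _) 2+∣q∣≤∣p∣)
... | x , x∈p , x∉q with ∃-outside p (⁅ x ⁆ ∪ q) (≤-trans (s≤s ∣x∪q∣≤1+∣q∣) 2+∣q∣≤∣p∣)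
  where
  ∣x∪q∣≤1+∣q∣ : ∣ ⁅ x ⁆ ∪ q ∣ ≤ 1 + ∣ q ∣
  ∣x∪q∣≤1+∣q∣ = ≤-trans (∣p∪q∣≤∣p∣+∣q∣ ⁅ x ⁆ q) (≤-reflexive (cong (_+ ∣ q ∣) (∣⁅x⁆∣≡1 x)))
... | y , y∈p , y∉x∪q =
  x , y , x∈p , y∈p , x∉q , (λ y∈q → y∉x∪q (x∈p∪q⁺ (inj₂ y∈q))) ,
  (λ { refl → y∉x∪q (x∈p∪q⁺ (inj₁ (x∈⁅x⁆ x))) })

∣p∣≤1 : ∀ {m} (p : Subset m) → (∀ {x y} → x ∈ p → y ∈ p → x ≡ y) → ∣ p ∣ ≤ 1
∣p∣≤1 {m} p single with nonempty? p
... | yes (x , x∈p) = ≤-trans (p⊆q⇒∣p∣≤∣q∣ p⊆⁅x⁆) (≤-reflexive (∣⁅x⁆∣≡1 x))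
  where
  p⊆⁅x⁆ : p ⊆ ⁅ x ⁆
  p⊆⁅x⁆ y∈p = subst (_∈ ⁅ x ⁆) (single x∈p y∈p) (x∈⁅x⁆ x)
... | no empty = ≤-trans (≤-reflexive (trans (cong ∣_∣ (Empty-unique empty)) (∣⊥∣≡0 m))) z≤n

⋃ : ∀ {m l} → Subset m → (Fin m → Subset l) → Subset l
⋃ [] F = ∅
⋃ (true ∷ q) F = F zero ∪ ⋃ q (λ i → F (suc i))
⋃ (false ∷ q) F = ⋃ q (λ i → F (suc i))

⊆-⋃ : ∀ {m l} (q : Subset m) (F : Fin m → Subset l) {s x} → s ∈ q → x ∈ F s → x ∈ ⋃ q F
⊆-⋃ (true ∷ q) F Vec.here x∈F = x∈p∪q⁺ (inj₁ x∈F)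
⊆-⋃ (true ∷ q) F (Vec.there s∈q) x∈F = x∈p∪q⁺ (inj₂ (⊆-⋃ q _ s∈q x∈F))
⊆-⋃ (false ∷ q) F (Vec.there s∈q) x∈F = ⊆-⋃ q _ s∈q x∈F

∣⋃∣≤∣q∣ : ∀ {m l} (q : Subset m) (F : Fin m → Subset l) →
  (∀ {s} → s ∈ q → ∣ F s ∣ ≤ 1) → ∣ ⋃ q F ∣ ≤ ∣ q ∣
∣⋃∣≤∣q∣ {l = l} [] F small = ≤-reflexive (∣⊥∣≡0 l)
∣⋃∣≤∣q∣ (true ∷ q) F small =
  ≤-trans (∣p∪q∣≤∣p∣+∣q∣ (F zero) _) (+-mono-≤ (small Vec.here) (∣⋃∣≤∣q∣ q _ (λ s∈q → small (Vec.there s∈q))))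
∣⋃∣≤∣q∣ (false ∷ q) F small = ∣⋃∣≤∣q∣ q _ (λ s∈q → small (Vec.there s∈q))

-- The arithmetic behind the upper bound: (k - 1) + (k - 2) = 2k - 3.
budget : ∀ a b k → 1 + a ≤ k → 2 + b ≤ k → a + b ≤ 2 * k ∸ 3
budget a b k a<k b+2≤k = m+n≤o⇒m≤o∸n (a + b) a+b+3≤2k
  where
  a+b+3≤2k : a + b + 3 ≤ 2 * k
  a+b+3≤2k = begin
    a + b + 3           ≡⟨ +-comm (a + b) 3 ⟩
    3 + (a + b)         ≡⟨ cong suc (sym (trans (+-suc a (suc b)) (cong suc (+-suc a b)))) ⟩
    (1 + a) + (2 + b)   ≤⟨ +-mono-≤ a<k b+2≤k ⟩
    k + k               ≡⟨ cong (k +_) (sym (+-identityʳ k)) ⟩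
    2 * k               ∎
    where open ≤-Reasoning

module Neighbourhood {n : ℕ} (G : Graph n) where
  open Graph G using (Adj; adj?)

  adj⇒∈nbhd : ∀ {u x} → Adj u x → x ∈ nbhd G u
  adj⇒∈nbhd {u} = ∈-select⁺ (adj? u)

  ∈nbhd⇒adj : ∀ {u x} → x ∈ nbhd G u → Adj u x
  ∈nbhd⇒adj {u} = ∈-select⁻ (adj? u)

  neighbour-avoiding : ∀ u → 3 ≤ degree G u → ∀ y z → ∃[ x ] (Adj u x × x ≢ y × x ≢ z)
  neighbour-avoiding u 3≤deg y z with ∃-outside (nbhd G u) (⁅ y ⁆ ∪ ⁅ z ⁆) (≤-trans (s≤s ∣yz∣≤2) 3≤deg)
    where
    ∣yz∣≤2 : ∣ ⁅ y ⁆ ∪ ⁅ z ⁆ ∣ ≤ 2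
    ∣yz∣≤2 = ≤-trans (∣p∪q∣≤∣p∣+∣q∣ ⁅ y ⁆ ⁅ z ⁆)
                     (≤-reflexive (trans (cong (_+ ∣ ⁅ z ⁆ ∣) (∣⁅x⁆∣≡1 y)) (cong suc (∣⁅x⁆∣≡1 z))))
  ... | x , x∈N , x∉yz =
    x , ∈nbhd⇒adj x∈N , (λ { refl → x∉yz (x∈p∪q⁺ (inj₁ (x∈⁅x⁆ x))) }) , (λ { refl → x∉yz (x∈p∪q⁺ (inj₂ (x∈⁅x⁆ x))) })

-- Consequences of girth ≥ 5, i.e. of every cycle having length suc m with 4 ≤ m.
module GirthFive {n : ℕ} (G : Graph n) (girth≥5 : ∀ m c → Cycle G m c → 4 ≤ m) where
  open Graph G renaming (sym to adj-sym)

  adj⇒≢ : ∀ {a b} → Adj a b → a ≢ b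
  adj⇒≢ a~b refl = irrefl a~b

  -- A triangle would be a cycle of length 3.
  no-triangle : ∀ {a b c} → Adj a b → Adj b c → Adj c a → ⊥
  no-triangle {a} {b} {c} a~b b~c c~a with girth≥5 2 cycle (s≤s (s≤s z≤n) , injective , edges , c~a)
    where
    cycle : Fin 3 → Fin n
    cycle zero = a
    cycle (suc zero) = b
    cycle (suc (suc zero)) = c
    injective : ∀ {i j} → cycle i ≡ cycle j → i ≡ j
    injective {zero} {zero} _ = refl
    injective {zero} {suc zero} e = ⊥-elim (adj⇒≢ a~b e)
    injective {zero} {suc (suc zero)} e = ⊥-elim (adj⇒≢ c~a (sym e))
    injective {suc zero} {zero} e = ⊥-elim (adj⇒≢ a~b (sym e))
    injective {suc zero} {suc zero} _ = refl
    injective {suc zero} {suc (suc zero)} e = ⊥-elim (adj⇒≢ b~c e)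
    injective {suc (suc zero)} {zero} e = ⊥-elim (adj⇒≢ c~a e)
    injective {suc (suc zero)} {suc zero} e = ⊥-elim (adj⇒≢ b~c (sym e))
    injective {suc (suc zero)} {suc (suc zero)} _ = refl
    edges : ∀ (i : Fin 2) → Adj (cycle (inject₁ i)) (cycle (suc i))
    edges zero = a~b
    edges (suc zero) = b~c
  ... | s≤s (s≤s ())

  -- A 4-cycle with distinct opposite corners would be a cycle of length 4.
  no-square : ∀ {a b c d} → Adj a b → Adj b c → Adj c d → Adj d a → a ≢ c → b ≢ d → ⊥
  no-square {a} {b} {c} {d} a~b b~c c~d d~a a≢c b≢d
    with girth≥5 3 cycle (s≤s (s≤s z≤n) , injective , edges , d~a)
    where
    cycle : Fin 4 → Fin n
    cycle zero = a
    cycle (suc zero) = b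
    cycle (suc (suc zero)) = c
    cycle (suc (suc (suc zero))) = d
    injective : ∀ {i j} → cycle i ≡ cycle j → i ≡ j
    injective {zero} {zero} _ = refl
    injective {zero} {suc zero} e = ⊥-elim (adj⇒≢ a~b e)
    injective {zero} {suc (suc zero)} e = ⊥-elim (a≢c e)
    injective {zero} {suc (suc (suc zero))} e = ⊥-elim (adj⇒≢ d~a (sym e))
    injective {suc zero} {zero} e = ⊥-elim (adj⇒≢ a~b (sym e))
    injective {suc zero} {suc zero} _ = refl
    injective {suc zero} {suc (suc zero)} e = ⊥-elim (adj⇒≢ b~c e)
    injective {suc zero} {suc (suc (suc zero))} e = ⊥-elim (b≢d e)
    injective {suc (suc zero)} {zero} e = ⊥-elim (a≢c (sym e))
    injective {suc (suc zero)} {suc zero} e = ⊥-elim (adj⇒≢ b~c (sym e))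
    injective {suc (suc zero)} {suc (suc zero)} _ = refl
    injective {suc (suc zero)} {suc (suc (suc zero))} e = ⊥-elim (adj⇒≢ c~d e)
    injective {suc (suc (suc zero))} {zero} e = ⊥-elim (adj⇒≢ d~a e)
    injective {suc (suc (suc zero))} {suc zero} e = ⊥-elim (b≢d (sym e))
    injective {suc (suc (suc zero))} {suc (suc zero)} e = ⊥-elim (adj⇒≢ c~d (sym e))
    injective {suc (suc (suc zero))} {suc (suc (suc zero))} _ = refl
    edges : ∀ (i : Fin 3) → Adj (cycle (inject₁ i)) (cycle (suc i))
    edges zero = a~b
    edges (suc zero) = b~c
    edges (suc (suc zero)) = c~d
  ... | s≤s (s≤s (s≤s ()))

  common-neighbour-unique : ∀ {x y a b} → x ≢ y → Adj x a → Adj y a → Adj x b → Adj y b → a ≡ b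
  common-neighbour-unique {a = a} {b} x≢y x~a y~a x~b y~b with a ≟ b
  ... | yes a≡b = a≡b
  ... | no a≢b = ⊥-elim (no-square x~a (adj-sym y~a) y~b (adj-sym x~b) x≢y a≢b)

  two-common-neighbours : ∀ {x y a b} → a ≢ b → Adj x a → Adj y a → Adj x b → Adj y b → x ≡ y
  two-common-neighbours {x} {y} a≢b x~a y~a x~b y~b with x ≟ y
  ... | yes x≡y = x≡y
  ... | no x≢y = ⊥-elim (a≢b (common-neighbour-unique x≢y x~a y~a x~b y~b))

module DiameterTwo {n : ℕ} (G : Graph n) (diameter≤2 : ∀ u v → ∃[ d ] (Dist G u v d × d ≤ 2)) where
  open Graph G using (Adj; adj?; irrefl)

  dist : Fin n → Fin n → ℕ
  dist x s with x ≟ s | adj? x s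
  ... | yes _ | _ = 0
  ... | no _ | yes _ = 1
  ... | no _ | no _ = 2

  dist-self : ∀ x → dist x x ≡ 0
  dist-self x with x ≟ x
  ... | yes _ = refl
  ... | no x≢x = ⊥-elim (x≢x refl)

  dist-adj : ∀ {x s} → Adj x s → dist x s ≡ 1
  dist-adj {x} {s} x~s with x ≟ s | adj? x s
  ... | yes refl | _ = ⊥-elim (irrefl x~s)
  ... | no _ | yes _ = refl
  ... | no _ | no x≁s = ⊥-elim (x≁s x~s)

  dist-far : ∀ {x s} → x ≢ s → ¬ Adj x s → dist x s ≡ 2
  dist-far {x} {s} x≢s x≁s with x ≟ s | adj? x s
  ... | yes x≡s | _ = ⊥-elim (x≢s x≡s)
  ... | no _ | yes x~s = ⊥-elim (x≁s x~s)
  ... | no _ | no _ = refl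

  dist≡0⇒≡ : ∀ {x s} → dist x s ≡ 0 → x ≡ s
  dist≡0⇒≡ {x} {s} d≡0 with x ≟ s | adj? x s | d≡0
  ... | yes x≡s | _ | _ = x≡s
  ... | no _ | yes _ | ()
  ... | no _ | no _ | ()

  dist≡1⇒adj : ∀ {x s} → dist x s ≡ 1 → Adj x s
  dist≡1⇒adj {x} {s} d≡1 with x ≟ s | adj? x s | d≡1
  ... | yes _ | _ | ()
  ... | no _ | yes x~s | _ = x~s
  ... | no _ | no _ | ()

  far-walk : ∀ {x s} → x ≢ s → ¬ Adj x s → Walk G x s 2
  far-walk {x} {s} x≢s x≁s with diameter≤2 x s
  ... | zero , (here , _) , _ = ⊥-elim (x≢s refl)
  ... | suc zero , (step x~s here , _) , _ = ⊥-elim (x≁s x~s)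
  ... | suc (suc zero) , (walk , _) , _ = walk
  ... | suc (suc (suc _)) , _ , s≤s (s≤s ())

  common-neighbour : ∀ {x s} → x ≢ s → ¬ Adj x s → ∃[ c ] (Adj x c × Adj c s)
  common-neighbour x≢s x≁s with far-walk x≢s x≁s
  ... | step x~c (step c~s here) = _ , x~c , c~s

  walk-of-length-dist : ∀ x s → Walk G x s (dist x s)
  walk-of-length-dist x s with x ≟ s | adj? x s
  ... | yes refl | _ = here
  ... | no _ | yes x~s = step x~s here
  ... | no x≢s | no x≁s = far-walk x≢s x≁s

  dist≤2 : ∀ x s → dist x s ≤ 2
  dist≤2 x s with x ≟ s | adj? x s
  ... | yes _ | _ = z≤n
  ... | no _ | yes _ = s≤s z≤n
  ... | no _ | no _ = ≤-refl

  dist-shortest : ∀ {x s m} → Walk G x s m → dist x s ≤ m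
  dist-shortest {x} here = ≤-reflexive (dist-self x)
  dist-shortest (step x~s here) = ≤-reflexive (dist-adj x~s)
  dist-shortest {x} {s} (step _ (step _ _)) = ≤-trans (dist≤2 x s) (s≤s (s≤s z≤n))

  Dist-dist : ∀ x s → Dist G x s (dist x s)
  Dist-dist x s = walk-of-length-dist x s , λ _ → dist-shortest

  Dist⇒≡dist : ∀ {x s d} → Dist G x s d → d ≡ dist x s
  Dist⇒≡dist {x} {s} (walk , shortest) = ≤-antisym (shortest _ (walk-of-length-dist x s)) (dist-shortest walk)

  Agree : Subset n → Fin n → Fin n → Set
  Agree S x y = ∀ s → s ∈ S → dist x s ≡ dist y s

  agree-sym : ∀ {S x y} → Agree S x y → Agree S y x
  agree-sym agree s s∈S = sym (agree s s∈S)

  resolving⇒separating : ∀ {S} → Resolving G S → ∀ x y → Agree S x y → x ≡ y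
  resolving⇒separating resolving x y agree = resolving x y λ s s∈S d dist-x →
    subst (Dist G y s) (sym (trans (Dist⇒≡dist dist-x) (agree s s∈S))) (Dist-dist y s)

  separating⇒resolving : ∀ {S} → (∀ x y → Agree S x y → x ≡ y) → Resolving G S
  separating⇒resolving separating x y same-dist =
    separating x y λ s s∈S → Dist⇒≡dist (same-dist s s∈S _ (Dist-dist x s))

module MooreBounds {n : ℕ} (G : Graph n) (k : ℕ) (3≤k : 3 ≤ k) (regular : Regular G k)
  (girth≥5 : ∀ m c → Cycle G m c → 4 ≤ m)
  (diameter≤2 : ∀ u v → ∃[ d ] (Dist G u v d × d ≤ 2)) where
  open Graph G using (Adj; adj?) renaming (sym to adj-sym)
  open Neighbourhood G
  open GirthFive G girth≥5
  open DiameterTwo G diameter≤2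

  neighbour : ∀ u y z → ∃[ x ] (Adj u x × x ≢ y × x ≢ z)
  neighbour u = neighbour-avoiding u (≤-trans 3≤k (≤-reflexive (sym (regular u))))

  CloseNeighbour : Fin n → Fin n → Fin n → Set
  CloseNeighbour s₀ s u = Adj s₀ u × (u ≡ s ⊎ Adj u s)

  close-neighbour? : ∀ s₀ s u → Dec (CloseNeighbour s₀ s u)
  close-neighbour? s₀ s u = adj? s₀ u ×-dec ((u ≟ s) ⊎-dec adj? u s)

  close-neighbours : Fin n → Fin n → Subset n
  close-neighbours s₀ s = select (close-neighbour? s₀ s)

  -- For s ≢ s₀ there is at most one, as two would close a short cycle.
  ∣close-neighbours∣≤1 : ∀ {s₀ s} → s ≢ s₀ → ∣ close-neighbours s₀ s ∣ ≤ 1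
  ∣close-neighbours∣≤1 {s₀} {s} s≢s₀ = ∣p∣≤1 _ λ u∈ u′∈ →
    unique (∈-select⁻ (close-neighbour? s₀ s) u∈) (∈-select⁻ (close-neighbour? s₀ s) u′∈)
    where
    unique : ∀ {u u′} → CloseNeighbour s₀ s u → CloseNeighbour s₀ s u′ → u ≡ u′
    unique (_ , inj₁ refl) (_ , inj₁ refl) = refl
    unique (s₀~s , inj₁ refl) (s₀~u′ , inj₂ u′~s) = ⊥-elim (no-triangle s₀~s (adj-sym u′~s) (adj-sym s₀~u′))
    unique (s₀~u , inj₂ u~s) (s₀~s , inj₁ refl) = ⊥-elim (no-triangle s₀~s (adj-sym u~s) (adj-sym s₀~u))
    unique (s₀~u , inj₂ u~s) (s₀~u′ , inj₂ u′~s) =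
      common-neighbour-unique (λ s₀≡s → s≢s₀ (sym s₀≡s)) s₀~u (adj-sym u~s) s₀~u′ (adj-sym u′~s)

  module _ (S : Subset n) (s₀ : Fin n) where

    marked : Subset n
    marked = ⋃ (S - s₀) (close-neighbours s₀)

    ∣marked∣≤ : ∣ marked ∣ ≤ ∣ S - s₀ ∣
    ∣marked∣≤ = ∣⋃∣≤∣q∣ (S - s₀) _ (λ s∈ → ∣close-neighbours∣≤1 (∈p-y⇒≢ s∈))

    unmarked-far : ∀ {u s} → Adj s₀ u → u ∉ marked → s ∈ S - s₀ → dist u s ≡ 2
    unmarked-far {u} {s} s₀~u u∉marked s∈ = dist-far
      (λ u≡s → u∉marked (⊆-⋃ (S - s₀) _ s∈ (∈-select⁺ (close-neighbour? s₀ s) (s₀~u , inj₁ u≡s))))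
      (λ u~s → u∉marked (⊆-⋃ (S - s₀) _ s∈ (∈-select⁺ (close-neighbour? s₀ s) (s₀~u , inj₂ u~s))))

    unmarked-agree : ∀ {x y} → Adj s₀ x → Adj s₀ y → x ∉ marked → y ∉ marked → Agree S x y
    unmarked-agree s₀~x s₀~y x∉marked y∉marked s s∈S with s ≟ s₀
    ... | yes refl = trans (dist-adj (adj-sym s₀~x)) (sym (dist-adj (adj-sym s₀~y)))
    ... | no s≢s₀ = trans (unmarked-far s₀~x x∉marked s∈) (sym (unmarked-far s₀~y y∉marked s∈))
      where
      s∈ : s ∈ S - s₀
      s∈ = x∈p∧x≢y⇒x∈p-y s∈S s≢s₀

    lower-bound-at : Resolving G S → k ≤ suc ∣ S - s₀ ∣
    lower-bound-at resolving with k ≤? suc ∣ S - s₀ ∣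
    ... | yes k≤ = k≤
    ... | no k≰ with two-outside (nbhd G s₀) marked (≤-trans (s≤s (s≤s ∣marked∣≤)) 2+∣S-s₀∣≤deg)
      where
      2+∣S-s₀∣≤deg : 2 + ∣ S - s₀ ∣ ≤ degree G s₀
      2+∣S-s₀∣≤deg = ≤-trans (≰⇒> k≰) (≤-reflexive (sym (regular s₀)))
    ... | x , y , x∈N , y∈N , x∉marked , y∉marked , x≢y = ⊥-elim (x≢y (resolving⇒separating resolving x y
          (unmarked-agree (∈nbhd⇒adj x∈N) (∈nbhd⇒adj y∈N) x∉marked y∉marked)))

  -- The empty set resolves nothing, so a resolving set has an element s₀.
  lower-bound : Fin n → ∀ S → Resolving G S → k ≤ ∣ S ∣
  lower-bound v S resolving with nonempty? S
  ... | yes (s₀ , s₀∈S) = ≤-trans (lower-bound-at S s₀ resolving) (x∈p⇒∣p-x∣<∣p∣ s₀∈S)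
  ... | no empty with neighbour v v v
  ...   | u , v~u , _ = ⊥-elim (adj⇒≢ v~u (resolving v u λ s s∈S → ⊥-elim (empty (s , s∈S))))

  module Construction (v u w : Fin n) (v~u : Adj v u) (u~w : Adj u w) (w≢v : w ≢ v) where

    A B S : Subset n
    A = nbhd G v - u
    B = nbhd G u - v - w
    S = A ∪ B

    ∈A⇒∈S : ∀ {s} → Adj v s → s ≢ u → s ∈ S
    ∈A⇒∈S v~s s≢u = x∈p∪q⁺ (inj₁ (x∈p∧x≢y⇒x∈p-y (adj⇒∈nbhd v~s) s≢u))

    ∈B⇒∈S : ∀ {s} → Adj u s → s ≢ v → s ≢ w → s ∈ S
    ∈B⇒∈S u~s s≢v s≢w = x∈p∪q⁺ (inj₂ (x∈p∧x≢y⇒x∈p-y (x∈p∧x≢y⇒x∈p-y (adj⇒∈nbhd u~s) s≢v) s≢w))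

    ∣S∣≤2k-3 : ∣ S ∣ ≤ 2 * k ∸ 3
    ∣S∣≤2k-3 = ≤-trans (∣p∪q∣≤∣p∣+∣q∣ A B) (budget ∣ A ∣ ∣ B ∣ k 1+∣A∣≤k 2+∣B∣≤k)
      where
      1+∣A∣≤k : 1 + ∣ A ∣ ≤ k
      1+∣A∣≤k = ≤-trans (x∈p⇒∣p-x∣<∣p∣ (adj⇒∈nbhd v~u)) (≤-reflexive (regular v))
      2+∣B∣≤k : 2 + ∣ B ∣ ≤ k
      2+∣B∣≤k = ≤-trans (s≤s (x∈p⇒∣p-x∣<∣p∣ (x∈p∧x≢y⇒x∈p-y (adj⇒∈nbhd u~w) w≢v)))
                        (≤-trans (x∈p⇒∣p-x∣<∣p∣ (adj⇒∈nbhd (adj-sym v~u))) (≤-reflexive (regular u)))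

    Generic : Fin n → Set
    Generic z = z ≢ v × ¬ Adj z v × ∃[ a ] (Adj z a × Adj a v × a ≢ u)

    data Outside : Fin n → Set where
      is-v : Outside v
      is-u : Outside u
      is-w : Outside w
      generic : ∀ {z} → Generic z → Outside z

    classify : ∀ z → z ∈ S ⊎ Outside z
    classify z with z ≟ v
    ... | yes refl = inj₂ is-v
    ... | no z≢v with adj? z v
    ...   | yes z~v with z ≟ u
    ...     | yes refl = inj₂ is-u
    ...     | no z≢u = inj₁ (∈A⇒∈S (adj-sym z~v) z≢u)
    classify z | no z≢v | no z≁v with common-neighbour z≢v z≁v
    ... | c , z~c , c~v with c ≟ u
    ...   | no c≢u = inj₂ (generic (z≢v , z≁v , c , z~c , c~v , c≢u))
    ...   | yes refl with z ≟ w
    ...     | yes refl = inj₂ is-w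
    ...     | no z≢w = inj₁ (∈B⇒∈S (adj-sym z~c) z≢v z≢w)

    transfer : ∀ {x y s} → Agree S x y → s ∈ S → Adj x s → Adj y s
    transfer agree s∈S x~s = dist≡1⇒adj (trans (sym (agree _ s∈S)) (dist-adj x~s))

    v-side≢u-side : ∀ {a m} → Adj a v → Adj m u → a ≢ m
    v-side≢u-side a~v m~u refl = no-triangle m~u (adj-sym v~u) (adj-sym a~v)

    towards-u : ∀ {z} → Generic z → ∃[ m ] (Adj z m × Adj m u)
    towards-u {z} (z≢v , z≁v , a , z~a , a~v , a≢u) = common-neighbour z≢u z≁u
      where
      z≢u : z ≢ u
      z≢u refl = z≁v (adj-sym v~u)
      z≁u : ¬ Adj z u
      z≁u z~u = a≢u (common-neighbour-unique z≢v z~a (adj-sym a~v) z~u v~u)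

    u-side∈S : ∀ {z m} → Generic z → Adj z m → Adj m u → m ≢ w → m ∈ S
    u-side∈S (_ , z≁v , _) z~m m~u m≢w = ∈B⇒∈S (adj-sym m~u) (λ { refl → z≁v z~m }) m≢w

    shared-u-side : ∀ {z y} → Generic z → Generic y → Agree S z y → ∃[ m ] (Adj z m × Adj y m × Adj m u)
    shared-u-side gz gy agree with towards-u gz | towards-u gy
    ... | m , z~m , m~u | m′ , y~m′ , m′~u with m ≟ w | m′ ≟ w
    ...   | no m≢w | _ = m , z~m , transfer agree (u-side∈S gz z~m m~u m≢w) z~m , m~u
    ...   | yes refl | no m′≢w = m′ , transfer (agree-sym agree) (u-side∈S gy y~m′ m′~u m′≢w) y~m′ , y~m′ , m′~u
    ...   | yes refl | yes refl = m , z~m , y~m′ , m~u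

    generic-vs-generic : ∀ {z y} → Generic z → Generic y → Agree S z y → z ≡ y
    generic-vs-generic gz@(_ , _ , a , z~a , a~v , a≢u) gy agree with shared-u-side gz gy agree
    ... | m , z~m , y~m , m~u =
      two-common-neighbours (v-side≢u-side a~v m~u) z~a (transfer agree (∈A⇒∈S (adj-sym a~v) a≢u) z~a) z~m y~m

    v-vs-u : ¬ Agree S v u
    v-vs-u agree with neighbour v u u
    ... | a , v~a , a≢u , _ = no-triangle (transfer agree (∈A⇒∈S v~a a≢u) v~a) (adj-sym v~a) v~u

    v-vs-w : ¬ Agree S v w
    v-vs-w agree with neighbour v u u
    ... | a , v~a , a≢u , _ =
      no-square v~a (adj-sym (transfer agree (∈A⇒∈S v~a a≢u) v~a)) (adj-sym u~w) (adj-sym v~u) (λ v≡w → w≢v (sym v≡w)) a≢u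

    v-vs-generic : ∀ {z} → Generic z → ¬ Agree S v z
    v-vs-generic (z≢v , _) agree with neighbour v u u
    ... | a , v~a , a≢u , _ with neighbour v u a
    ...   | a′ , v~a′ , a′≢u , a′≢a =
      z≢v (sym (two-common-neighbours a′≢a v~a′ (transfer agree (∈A⇒∈S v~a′ a′≢u) v~a′)
                                      v~a (transfer agree (∈A⇒∈S v~a a≢u) v~a)))

    u-vs-w : ¬ Agree S u w
    u-vs-w agree with neighbour u v w
    ... | b , u~b , b≢v , b≢w = no-triangle u~b (adj-sym (transfer agree (∈B⇒∈S u~b b≢v b≢w) u~b)) (adj-sym u~w)

    u-vs-generic : ∀ {z} → Generic z → ¬ Agree S u z
    u-vs-generic (_ , _ , a , z~a , a~v , a≢u) agree =
      no-triangle (transfer (agree-sym agree) (∈A⇒∈S (adj-sym a~v) a≢u) z~a) a~v v~u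

    w-vs-generic : ∀ {z} → Generic z → ¬ Agree S w z
    w-vs-generic (_ , _ , a , z~a , a~v , a≢u) agree =
      no-square (adj-sym a~v) (adj-sym (transfer (agree-sym agree) (∈A⇒∈S (adj-sym a~v) a≢u) z~a)) (adj-sym u~w) (adj-sym v~u)
                (λ v≡w → w≢v (sym v≡w)) a≢u

    separate : ∀ {x y} → Agree S x y → Outside x → Outside y → x ≡ y
    separate agree is-v is-v = refl
    separate agree is-v is-u = ⊥-elim (v-vs-u agree)
    separate agree is-v is-w = ⊥-elim (v-vs-w agree)
    separate agree is-v (generic gy) = ⊥-elim (v-vs-generic gy agree)
    separate agree is-u is-v = ⊥-elim (v-vs-u (agree-sym agree))
    separate agree is-u is-u = refl
    separate agree is-u is-w = ⊥-elim (u-vs-w agree)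
    separate agree is-u (generic gy) = ⊥-elim (u-vs-generic gy agree)
    separate agree is-w is-v = ⊥-elim (v-vs-w (agree-sym agree))
    separate agree is-w is-u = ⊥-elim (u-vs-w (agree-sym agree))
    separate agree is-w is-w = refl
    separate agree is-w (generic gy) = ⊥-elim (w-vs-generic gy agree)
    separate agree (generic gx) is-v = ⊥-elim (v-vs-generic gx (agree-sym agree))
    separate agree (generic gx) is-u = ⊥-elim (u-vs-generic gx (agree-sym agree))
    separate agree (generic gx) is-w = ⊥-elim (w-vs-generic gx (agree-sym agree))
    separate agree (generic gx) (generic gy) = generic-vs-generic gx gy agree

    -- A vertex of S is recognised by its distance 0 to itself; the rest is separation.
    S-resolving : Resolving G S
    S-resolving = separating⇒resolving separating
      where
      separating : ∀ x y → Agree S x y → x ≡ y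
      separating x y agree with classify x | classify y
      ... | inj₁ x∈S | _ = sym (dist≡0⇒≡ (trans (sym (agree x x∈S)) (dist-self x)))
      ... | inj₂ _ | inj₁ y∈S = dist≡0⇒≡ (trans (agree y y∈S) (dist-self y))
      ... | inj₂ x-out | inj₂ y-out = separate agree x-out y-out

  upper-bound : Fin n → ∃[ S ] (Resolving G S × ∣ S ∣ ≤ 2 * k ∸ 3)
  upper-bound v with neighbour v v v
  ... | u , v~u , _ with neighbour u v v
  ...   | w , u~w , w≢v , _ = S , S-resolving , ∣S∣≤2k-3
    where open Construction v u w v~u u~w w≢v

-- The diameter hypothesis supplies a vertex to start from; girth 5 bounds every cycle.
mainTheorem9 : (k n : ℕ) (G : Graph n) → 3 ≤ k →
    Regular G k → Diameter G 2 → Girth G 5 →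
    ((S : Subset n) → Resolving G S → k ≤ ∣ S ∣)
    × (∃[ S ] (Resolving G S × ∣ S ∣ ≤ 2 * k ∸ 3))
mainTheorem9 k n G 3≤k regular (diameter≤2 , v , _) (_ , girth≥5) =
  lower-bound v , upper-bound v
  where open MooreBounds G k 3≤k regular girth≥5 diameter≤2
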